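{- Let $\mathcal M=(U,\mathcal L)$ be a COM, $X\in\mathcal L$, $S\in\mathrm{Samp}(\mathcal M)$ with $\mathrm{Sep}(X,S)=\varnothing$, $\widehat S=X\circ S$ and $\widehat{\widehat S}=\widehat S\setminus\underline X$. Then: (i) $\mathrm{osc}([\widehat{\widehat S}])=\mathrm{osc}([\widehat S])=\mathrm{osc}([S])\cap X^0$, where $\mathrm{osc}([\widehat S])$ is considered in $[X]$, $\mathrm{osc}([\widehat{\widehat S}])$ in $G(\mathcal M(X))$, and $\mathrm{osc}([S])$ in $G(\mathcal M)$; (ii) $\widehat{\widehat S}^{\,0}=\widehat S^{\,0}=S^0\cap X^0$.
   Context: Sign vectors $X:U\to\{ -1,0,+1\}$, support $\underline X$, zero set $X^0=U\setminus\underline X$, $(X\circ Y)_e=X_e$ if $X_e\ne0$ else $Y_e$, $\mathrm{Sep}(X,Y)=\{e:X_eY_e=-1\}$, $X\le Y$ iff $X_e\in\{0,Y_e\}$ for all $e$; $X\setminus A$ is the restriction to $U\setminus A$. A COM $\mathcal M=(U,\mathcal L)$ is $\mathcal L\subseteq\{ -1,0,+1\}^U$ satisfying (FS) $X\circ(-Y)\in\mathcal L$ and (SE) for $e\in\mathrm{Sep}(X,Y)$ some $Z\in\mathcal L$ has $Z_e=0$, $Z_f=(X\circ Y)_f$ for $f\notin\mathrm{Sep}(X,Y)$; assumed simple. Topes: maximal elements of $(\mathcal L,\le)$; tope graph $G(\mathcal M)$: topes adjacent iff differing in one coordinate. $F(X)=\{Y\in\mathcal L:X\le Y\}$, $[X]$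 the subgraph of $G(\mathcal M)$ induced by topes of $F(X)$; $\mathcal M(X)=(U\setminus\underline X,\{Y\setminus\underline X:Y\in\mathcal L\})$. $\mathrm{Samp}(\mathcal M)=\{S\in\{ -1,0,+1\}^U:S\le T$ for some tope $T\}$; for a sample $S$, $[S]$ is the subgraph of the relevant tope graph induced by topes $T\ge S$. In a graph $G$ on $\{\pm1\}$-vectors, $E_e$ is the set of edges whose endpoints differ in coordinate $e$; for an induced subgraph $H$ of $G$, $e\in\mathrm{osc}(H)$ (considered in $G$) if $H$ contains no edge of $E_e$ but some edge of $E_e$ in $G$ has exactly one endpoint in $H$. -}

module Defs where

open import Data.Nat using (ℕ)
open import Data.Fin using (Fin)
open import Data.Product using (Σ; Σ-syntax; _×_; _,_; proj₁)
open import Data.Sum using (_⊎_)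
open import Relation.Binary.PropositionalEquality using (_≡_; _≢_)
open import Relation.Nullary using (¬_)

data Sign : Set where
  neg zer pos : Sign

-_ˢ : Sign → Sign
- neg ˢ = pos
- zer ˢ = zer
- pos ˢ = neg

_·ˢ_ : Sign → Sign → Sign
zer ·ˢ _ = zer
pos ·ˢ y = y
neg ·ˢ y = - y ˢ

SV : Set → Set
SV U = U → Sign

SVSet : Set → Set₁
SVSet U = SV U → Set

module _ {U : Set} where

  negV : SV U → SV U
  negV X e = - X e ˢ

  compˢ : Sign → Sign → Sign
  compˢ zer y = y
  compˢ x   _ = x

  _⊚_ : SV U → SV U → SV U
  (X ⊚ Y) e = compˢ (X e) (Y e)

  Sep : SV U → SV U → U → Set
  Sep X Y e = (X e ·ˢ Y e) ≡ neg

  Zero : SV U → U → Set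
  Zero X e = X e ≡ zer

  _≤ᵛ_ : SV U → SV U → Set
  X ≤ᵛ Y = ∀ e → (X e ≡ zer) ⊎ (X e ≡ Y e)

  IsTope : SVSet U → SV U → Set
  IsTope L T = L T × (∀ Y → L Y → T ≤ᵛ Y → Y ≤ᵛ T)

  Samp : SVSet U → SV U → Set
  Samp L S = Σ[ T ∈ SV U ] (IsTope L T × S ≤ᵛ T)

  -- [S] : vertex predicate of the subgraph induced by topes T ≥ S
  Brk : SVSet U → SV U → SV U → Set
  Brk L S T = IsTope L T × S ≤ᵛ T

  -- Topes of F(X) (vertices of [X])
  FaceTope : SVSet U → SV U → SV U → Set
  FaceTope L X T = IsTope L T × X ≤ᵛ T

  DiffOnly : U → SV U → SV U → Set
  DiffOnly e T T' = (T e ≢ T' e) × (∀ f → f ≢ e → T f ≡ T' f)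

  -- oscillation: graph G given by its vertex predicate V (edges = pairs of
  -- vertices differing in exactly one coordinate), H an induced subgraph
  -- given by its vertex predicate (H ⊆ V).
  -- e ∈ osc(H) (in G) iff H contains no edge of E_e but some edge of E_e of G
  -- has exactly one endpoint in H.
  Osc : (V H : SV U → Set) → U → Set
  Osc V H e =
    (¬ (Σ[ T ∈ SV U ] Σ[ T' ∈ SV U ]
          (V T × V T' × DiffOnly e T T' × H T × H T')))
    × (Σ[ T ∈ SV U ] Σ[ T' ∈ SV U ]
          (V T × V T' × DiffOnly e T T' × H T × ¬ H T'))

record IsCOM {n : ℕ} (L : SVSet (Fin n)) : Set where
  field
    FS : ∀ X Y → L X → L Y → L (X ⊚ negV Y)
    SE : ∀ X Y → L X → L Y → ∀ e → Sep X Y e →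
         Σ[ Z ∈ SV (Fin n) ] (L Z × Z e ≡ zer ×
           (∀ f → ¬ Sep X Y f → Z f ≡ (X ⊚ Y) f))
    simple₁ : ∀ e s → Σ[ X ∈ SV (Fin n) ] (L X × X e ≡ s)
    simple₂ : ∀ e f → e ≢ f →
      Σ[ X ∈ SV (Fin n) ] Σ[ Y ∈ SV (Fin n) ]
        (L X × L Y × (X e ·ˢ X f) ≡ pos × (Y e ·ˢ Y f) ≡ neg)

-- Restriction M(X) = (U ∖ supp X, {Y ∖ supp X : Y ∈ L}); its ground set is
-- the zero set of X, represented as a Σ-type.
ZeroSet : {n : ℕ} → SV (Fin n) → Set
ZeroSet {n} X = Σ[ e ∈ Fin n ] (X e ≡ zer)

restrict : {n : ℕ} (X : SV (Fin n)) → SV (Fin n) → SV (ZeroSet X)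
restrict X Y e' = Y (proj₁ e')

Contr : {n : ℕ} → SVSet (Fin n) → (X : SV (Fin n)) → SVSet (ZeroSet X)
Contr L X Y' = Σ[ Y ∈ SV (Fin _) ] (L Y × (∀ e' → Y' e' ≡ restrict X Y e'))

-- A tope of a COM is exactly an element of L without zero entries, so every
-- edge of [X] is the composition X ∘ T of an edge of G(M) in a direction of
-- X⁰, and restricting to X⁰ turns it into an edge of G(M(X)) and back.
-- Moreover, e ∈ osc([S]) holds iff S_e ≠ 0 and some E_e-edge has an endpoint
-- above S: its endpoints agree off e, so they lie on the same side of [S]
-- exactly when S_e = 0. Both parts of (i) thus reduce to transporting such
-- edges between G(M), [X] and G(M(X)), while (ii) is read off the definition
-- of composition.
module Submission where

open import Defs
open import Data.Nat using (ℕ)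
open import Data.Fin using (Fin)
open import Data.Product using (Σ-syntax; _×_; _,_; proj₁; map₂)
open import Data.Sum using (_⊎_; inj₁; inj₂)
open import Function using (_∘_; id)
open import Function.Bundles using (_⇔_; mk⇔; module Equivalence)
open import Relation.Binary.PropositionalEquality
  using (_≡_; _≢_; _≗_; refl; sym; trans; cong; cong₂; module ≡-Reasoning)
open import Relation.Binary.Definitions using (DecidableEquality)
open import Relation.Nullary using (¬_; yes; no; contradiction)
open import Axiom.UniquenessOfIdentityProofs using (module Decidable⇒UIP)

open Equivalence using (to; from)

_≟ˢ_ : DecidableEquality Sign
neg ≟ˢ neg = yes refl
neg ≟ˢ zer = no λ ()
neg ≟ˢ pos = no λ ()
zer ≟ˢ neg = no λ ()
zer ≟ˢ zer = yes refl
zer ≟ˢ pos = no λ ()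
pos ≟ˢ neg = no λ ()
pos ≟ˢ zer = no λ ()
pos ≟ˢ pos = yes refl

-ˢ-involutive : ∀ s → - (- s ˢ) ˢ ≡ s
-ˢ-involutive neg = refl
-ˢ-involutive zer = refl
-ˢ-involutive pos = refl

-ˢ-nonzero : ∀ {s} → s ≢ zer → - s ˢ ≢ zer
-ˢ-nonzero {s} s≢0 −s≡0 = s≢0 (trans (sym (-ˢ-involutive s)) (cong -_ˢ −s≡0))

-- compˢ carries a spurious implicit ground set, and compˢ {A} x y and
-- compˢ {B} x y are not definitionally equal when x is neutral.
compˢ-irrelevant : {A B : Set} (x y : Sign) → compˢ {A} x y ≡ compˢ {B} x y
compˢ-irrelevant neg y = refl
compˢ-irrelevant zer y = refl
compˢ-irrelevant pos y = refl

_≤ˢ_ : Sign → Sign → Set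
a ≤ˢ b = a ≡ zer ⊎ a ≡ b

≤ˢ-respʳ : ∀ {a b c} → b ≡ c → a ≤ˢ b → a ≤ˢ c
≤ˢ-respʳ refl a≤b = a≤b

≤ˢ-trans : ∀ {a b c} → a ≤ˢ b → b ≤ˢ c → a ≤ˢ c
≤ˢ-trans (inj₁ a≡0) _   = inj₁ a≡0
≤ˢ-trans (inj₂ refl) b≤c = b≤c

≤ˢ-zer : ∀ {a} → a ≤ˢ zer → a ≡ zer
≤ˢ-zer (inj₁ a≡0) = a≡0
≤ˢ-zer (inj₂ a≡0) = a≡0

≤ˢ-by-nonzero : ∀ {a b} → (a ≢ zer → a ≤ˢ b) → a ≤ˢ b
≤ˢ-by-nonzero {neg} h = h λ ()
≤ˢ-by-nonzero {zer} h = inj₁ refl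
≤ˢ-by-nonzero {pos} h = h λ ()

nonzero-≤ˢ⇒≡ : ∀ {a b} → a ≢ zer → a ≤ˢ b → a ≡ b
nonzero-≤ˢ⇒≡ a≢0 (inj₁ a≡0) = contradiction a≡0 a≢0
nonzero-≤ˢ⇒≡ a≢0 (inj₂ a≡b) = a≡b

module _ {U : Set} where

  ⊚-zeroˡ : {X Y : SV U} {e : U} → X e ≡ zer → (X ⊚ Y) e ≡ Y e
  ⊚-zeroˡ {X} {e = e} Xe≡0 rewrite Xe≡0 = refl

  ⊚-nonzero : {X Y : SV U} {e : U} → (X e ≡ zer → Y e ≢ zer) → (X ⊚ Y) e ≢ zer
  ⊚-nonzero {X} {e = e} h with X e
  ... | neg = λ ()
  ... | zer = h refl
  ... | pos = λ ()

  ⊚-zero⇔ : {X Y : SV U} {e : U} → (X ⊚ Y) e ≡ zer ⇔ (Y e ≡ zer × X e ≡ zer)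
  ⊚-zero⇔ {X} {Y} {e} = mk⇔ split (λ (Ye≡0 , Xe≡0) → trans (⊚-zeroˡ {X} {Y} Xe≡0) Ye≡0)
    where
    split : (X ⊚ Y) e ≡ zer → Y e ≡ zer × X e ≡ zer
    split XYe≡0 with X e
    ... | zer = XYe≡0 , refl

  ⊚-congʳ-on-zero : {X Y Y' : SV U} {e : U} →
    (X e ≡ zer → Y e ≡ Y' e) → (X ⊚ Y) e ≡ (X ⊚ Y') e
  ⊚-congʳ-on-zero {X} {e = e} h with X e
  ... | neg = refl
  ... | zer = h refl
  ... | pos = refl

  ⊚-monoʳ-on-zero : {X Y Y' : SV U} {e : U} →
    (X e ≡ zer → (X ⊚ Y) e ≤ˢ Y' e) → (X ⊚ Y) e ≤ˢ (X ⊚ Y') e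
  ⊚-monoʳ-on-zero {X} {e = e} h with X e
  ... | neg = inj₂ refl
  ... | zer = h refl
  ... | pos = inj₂ refl

  ≤ᵛ-⊚ : (X Y : SV U) → X ≤ᵛ (X ⊚ Y)
  ≤ᵛ-⊚ X Y e with X e
  ... | neg = inj₂ refl
  ... | zer = inj₁ refl
  ... | pos = inj₂ refl

  ≤ᵛ-⊚-unseparated : (X Y : SV U) → (∀ e → ¬ Sep X Y e) → Y ≤ᵛ (X ⊚ Y)
  ≤ᵛ-⊚-unseparated X Y noSep e with X e | Y e | noSep e
  ... | _   | zer | _ = inj₁ refl
  ... | zer | neg | _ = inj₂ refl
  ... | zer | pos | _ = inj₂ refl
  ... | neg | neg | _ = inj₂ refl
  ... | pos | pos | _ = inj₂ refl
  ... | neg | pos | ¬sep = contradiction refl ¬sep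
  ... | pos | neg | ¬sep = contradiction refl ¬sep

  ⊚-negV-⊚-negV : (X Y : SV U) → X ⊚ negV (X ⊚ negV Y) ≗ X ⊚ Y
  ⊚-negV-⊚-negV X Y e with X e
  ... | neg = refl
  ... | zer = -ˢ-involutive (Y e)
  ... | pos = refl

  ≤ᵛ-trans : {X Y Z : SV U} → X ≤ᵛ Y → Y ≤ᵛ Z → X ≤ᵛ Z
  ≤ᵛ-trans X≤Y Y≤Z e = ≤ˢ-trans (X≤Y e) (Y≤Z e)

  ≤ᵛ-respʳ-≗ : {X Y Z : SV U} → Y ≗ Z → X ≤ᵛ Y → X ≤ᵛ Z
  ≤ᵛ-respʳ-≗ Y≗Z X≤Y e = ≤ˢ-respʳ (Y≗Z e) (X≤Y e)

  ⊚-DiffOnly : {X Y Y' T T' : SV U} {e : U} → T ≗ X ⊚ Y → T' ≗ X ⊚ Y' →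
    X e ≡ zer → Y e ≢ Y' e → (∀ f → f ≢ e → X f ≡ zer → Y f ≡ Y' f) → DiffOnly e T T'
  ⊚-DiffOnly {X} {Y} {Y'} {T} {T'} {e} T≗X∘Y T'≗X∘Y' Xe≡0 Ye≢Y'e agree =
    (λ Te≡T'e → Ye≢Y'e (begin
       Y e        ≡⟨ sym (⊚-zeroˡ {X = X} {Y = Y} Xe≡0) ⟩
       (X ⊚ Y) e  ≡⟨ sym (T≗X∘Y e) ⟩
       T e        ≡⟨ Te≡T'e ⟩
       T' e       ≡⟨ T'≗X∘Y' e ⟩
       (X ⊚ Y') e ≡⟨ ⊚-zeroˡ {X = X} {Y = Y'} Xe≡0 ⟩
       Y' e       ∎)) ,
    λ f f≢e → begin
      T f        ≡⟨ T≗X∘Y f ⟩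
      (X ⊚ Y) f  ≡⟨ ⊚-congʳ-on-zero {X = X} {Y = Y} {Y' = Y'} (agree f f≢e) ⟩
      (X ⊚ Y') f ≡⟨ T'≗X∘Y' f ⟨
      T' f       ∎
    where open ≡-Reasoning

  IncidentEdge : (V : SV U → Set) → SV U → U → Set
  IncidentEdge V S e =
    Σ[ T ∈ SV U ] Σ[ T' ∈ SV U ] (V T × V T' × DiffOnly e T T' × S ≤ᵛ T)

  IncidentEdge-monoᵛ : {V W : SV U → Set} {S : SV U} {e : U} →
    (∀ {T} → V T → W T) → IncidentEdge V S e → IncidentEdge W S e
  IncidentEdge-monoᵛ V⊆W (T , T' , VT , VT' , d , S≤T) = T , T' , V⊆W VT , V⊆W VT' , d , S≤T

  IncidentEdge-antitoneˢ : {V : SV U → Set} {S S' : SV U} {e : U} →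
    S' ≤ᵛ S → IncidentEdge V S e → IncidentEdge V S' e
  IncidentEdge-antitoneˢ S'≤S (T , T' , VT , VT' , d , S≤T) =
    T , T' , VT , VT' , d , ≤ᵛ-trans S'≤S S≤T

  DiffOnly-≤ᵛ : {S T T' : SV U} {e : U} → S e ≡ zer → DiffOnly e T T' → S ≤ᵛ T → S ≤ᵛ T'
  DiffOnly-≤ᵛ Se≡0 (_ , agree) S≤T f =
    ≤ˢ-by-nonzero λ Sf≢0 → ≤ˢ-respʳ (agree f λ { refl → Sf≢0 Se≡0 }) (S≤T f)

  ≤ᵛ-nonzero-agree : {S T T' : SV U} {e : U} → S e ≢ zer → S ≤ᵛ T → S ≤ᵛ T' → T e ≡ T' e
  ≤ᵛ-nonzero-agree {e = e} Se≢0 S≤T S≤T' =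
    trans (sym (nonzero-≤ˢ⇒≡ Se≢0 (S≤T e))) (nonzero-≤ˢ⇒≡ Se≢0 (S≤T' e))

  ≤ᵛ-DiffOnly⇒zero : {X T T' : SV U} {e : U} → X ≤ᵛ T → X ≤ᵛ T' → DiffOnly e T T' → X e ≡ zer
  ≤ᵛ-DiffOnly⇒zero {e = e} X≤T X≤T' (Te≢T'e , _) with X≤T e | X≤T' e
  ... | inj₁ Xe≡0  | _           = Xe≡0
  ... | inj₂ _     | inj₁ Xe≡0   = Xe≡0
  ... | inj₂ Xe≡Te | inj₂ Xe≡T'e = contradiction (trans (sym Xe≡Te) Xe≡T'e) Te≢T'e

  Osc-⇔ : (V A : SV U → Set) → (∀ {T} → V T → A T) → (S : SV U) (e : U) →
    Osc V (λ T → A T × S ≤ᵛ T) e ⇔ (S e ≢ zer × IncidentEdge V S e)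
  Osc-⇔ V A V⊆A S e = mk⇔ osc⇒edge edge⇒osc
    where
    osc⇒edge : Osc V (λ T → A T × S ≤ᵛ T) e → S e ≢ zer × IncidentEdge V S e
    osc⇒edge (_ , T , T' , VT , VT' , d , (_ , S≤T) , T'∉) =
      (λ Se≡0 → T'∉ (V⊆A VT' , DiffOnly-≤ᵛ Se≡0 d S≤T)) , (T , T' , VT , VT' , d , S≤T)
    edge⇒osc : S e ≢ zer × IncidentEdge V S e → Osc V (λ T → A T × S ≤ᵛ T) e
    edge⇒osc (Se≢0 , T , T' , VT , VT' , d , S≤T) =
      (λ (_ , _ , _ , _ , d' , (_ , S≤T₁) , (_ , S≤T₂)) →
         proj₁ d' (≤ᵛ-nonzero-agree Se≢0 S≤T₁ S≤T₂)) ,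
      (T , T' , VT , VT' , d , (V⊆A VT , S≤T) ,
       λ (_ , S≤T') → proj₁ d (≤ᵛ-nonzero-agree Se≢0 S≤T S≤T'))

FaceSymmetric : {U : Set} → SVSet U → Set
FaceSymmetric {U} L = (X Y : SV U) → L X → L Y → L (X ⊚ negV Y)

module _ {U : Set} {L : SVSet U} where

  nonzero⇒tope : {T : SV U} → L T → (∀ e → T e ≢ zer) → IsTope L T
  nonzero⇒tope {T} LT T≢0 = LT , λ Y _ T≤Y e → T≤Y⇒Y≤T e (T≤Y e)
    where
    T≤Y⇒Y≤T : ∀ {y} e → T e ≤ˢ y → y ≤ˢ T e
    T≤Y⇒Y≤T e (inj₁ Te≡0) = contradiction Te≡0 (T≢0 e)
    T≤Y⇒Y≤T e (inj₂ Te≡y) = inj₂ (sym Te≡y)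

  -- T ∘ (−Z) lies above T, so it equals T by maximality; where T vanishes it is −Z.
  tope⇒nonzero : FaceSymmetric L → (∀ e → Σ[ Z ∈ SV U ] (L Z × Z e ≢ zer)) →
    {T : SV U} → IsTope L T → ∀ e → T e ≢ zer
  tope⇒nonzero fs witness {T} (LT , maximal) e Te≡0 with witness e
  ... | Z , LZ , Ze≢0 =
    ⊚-nonzero {X = T} {Y = negV Z} (λ _ → -ˢ-nonzero Ze≢0)
      (≤ˢ-zer (≤ˢ-respʳ Te≡0 (maximal (T ⊚ negV Z) (fs T Z LT LZ) (≤ᵛ-⊚ T (negV Z)) e)))

  ⊚-closed : FaceSymmetric L → {X Y : SV U} → L X → L Y →
    Σ[ Z ∈ SV U ] (L Z × Z ≗ X ⊚ Y)
  ⊚-closed fs {X} {Y} LX LY =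
    X ⊚ negV (X ⊚ negV Y) , fs X _ LX (fs X Y LX LY) , ⊚-negV-⊚-negV X Y

  ⊚-faceTope : FaceSymmetric L → {X Y : SV U} → L X → L Y → (∀ f → X f ≡ zer → Y f ≢ zer) →
    Σ[ T ∈ SV U ] (FaceTope L X T × T ≗ X ⊚ Y)
  ⊚-faceTope fs {X} {Y} LX LY Y≢0 with ⊚-closed fs LX LY
  ... | T , LT , T≗X∘Y =
    T , (nonzero⇒tope LT T≢0 , ≤ᵛ-respʳ-≗ (sym ∘ T≗X∘Y) (≤ᵛ-⊚ X Y)) , T≗X∘Y
    where
    T≢0 : ∀ f → T f ≢ zer
    T≢0 f Tf≡0 = ⊚-nonzero {X = X} {Y = Y} (Y≢0 f) (trans (sym (T≗X∘Y f)) Tf≡0)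

module _ {n : ℕ} {L : SVSet (Fin n)} (com : IsCOM L) where
  open IsCOM com

  nonzero-witness : ∀ e → Σ[ Z ∈ SV (Fin n) ] (L Z × Z e ≢ zer)
  nonzero-witness e with simple₁ e pos
  ... | Z , LZ , Ze≡pos = Z , LZ , λ Ze≡0 → pos≢zer (trans (sym Ze≡pos) Ze≡0)
    where
    pos≢zer : pos ≢ zer
    pos≢zer ()

  tope-nonzero : {T : SV (Fin n)} → IsTope L T → ∀ e → T e ≢ zer
  tope-nonzero = tope⇒nonzero FS nonzero-witness

  module _ {X : SV (Fin n)} where

    Contr-FaceSymmetric : FaceSymmetric (Contr L X)
    Contr-FaceSymmetric Y' Z' (Y , LY , Y'≗Y) (Z , LZ , Z'≗Z) =
      Y ⊚ negV Z , FS Y Z LY LZ ,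
      λ f' → trans (cong₂ (compˢ {ZeroSet X}) (Y'≗Y f') (cong -_ˢ (Z'≗Z f')))
                   (compˢ-irrelevant {ZeroSet X} {Fin n} (Y (proj₁ f')) (- Z (proj₁ f') ˢ))

    contrTope-nonzero : {T : SV (ZeroSet X)} → IsTope (Contr L X) T → ∀ e' → T e' ≢ zer
    contrTope-nonzero = tope⇒nonzero Contr-FaceSymmetric witness
      where
      witness : ∀ e' → Σ[ Z' ∈ SV (ZeroSet X) ] (Contr L X Z' × Z' e' ≢ zer)
      witness (e , _) with nonzero-witness e
      ... | Z , LZ , Ze≢0 = restrict X Z , (Z , LZ , λ _ → refl) , Ze≢0

    restrict-tope : {T : SV (Fin n)} → IsTope L T → IsTope (Contr L X) (restrict X T)
    restrict-tope {T} tope@(LT , _) =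
      nonzero⇒tope (T , LT , λ _ → refl) (λ (e , _) → tope-nonzero tope e)

    restrict-DiffOnly : {T T' : SV (Fin n)} {e : Fin n} (p : X e ≡ zer) →
      DiffOnly e T T' → DiffOnly (e , p) (restrict X T) (restrict X T')
    restrict-DiffOnly p (Te≢T'e , agree) =
      Te≢T'e , λ (f , q) f'≢ep → agree f λ { refl → f'≢ep (cong (f ,_) (uip q p)) }
      where uip = Decidable⇒UIP.≡-irrelevant _≟ˢ_

    restrict-incident : {S : SV (Fin n)} {e : Fin n} (p : X e ≡ zer) →
      IncidentEdge (IsTope L) S e → IncidentEdge (IsTope (Contr L X)) (restrict X S) (e , p)
    restrict-incident p (T , T' , tT , tT' , d , S≤T) =
      restrict X T , restrict X T' , restrict-tope tT , restrict-tope tT' ,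
      restrict-DiffOnly p d , S≤T ∘ proj₁

    nonzero-on-X⁰ : {T̃ : SV (ZeroSet X)} {Y : SV (Fin n)} → IsTope (Contr L X) T̃ →
      T̃ ≗ restrict X Y → ∀ f → X f ≡ zer → Y f ≢ zer
    nonzero-on-X⁰ tT̃ T̃≗Y f q Yf≡0 = contrTope-nonzero tT̃ (f , q) (trans (T̃≗Y (f , q)) Yf≡0)

    lift-incident : L X → {S : SV (Fin n)} {e : Fin n} (p : X e ≡ zer) →
      IncidentEdge (IsTope (Contr L X)) (restrict X (X ⊚ S)) (e , p) →
      IncidentEdge (FaceTope L X) (X ⊚ S) e
    lift-incident LX {S} p
      ( T̃ , T̃' , tT̃@((Y , LY , T̃≗Y) , _) , tT̃'@((Y' , LY' , T̃'≗Y') , _)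
      , (T̃e≢T̃'e , agree) , Ŝ≤T̃)
      with ⊚-faceTope FS LX LY (nonzero-on-X⁰ tT̃ T̃≗Y)
         | ⊚-faceTope FS LX LY' (nonzero-on-X⁰ tT̃' T̃'≗Y')
    ... | T , faceT , T≗X∘Y | T' , faceT' , T'≗X∘Y' =
      T , T' , faceT , faceT' ,
      ⊚-DiffOnly T≗X∘Y T'≗X∘Y' p
        (λ Ye≡Y'e → T̃e≢T̃'e (trans (T̃≗Y _) (trans Ye≡Y'e (sym (T̃'≗Y' _)))))
        (λ f f≢e q → trans (sym (T̃≗Y (f , q)))
                       (trans (agree (f , q) (f≢e ∘ cong proj₁)) (T̃'≗Y' (f , q)))) ,
      ≤ᵛ-respʳ-≗ (sym ∘ T≗X∘Y)
        (λ f → ⊚-monoʳ-on-zero {X = X} {Y = S} {Y' = Y}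
                 λ q → ≤ˢ-respʳ (T̃≗Y (f , q)) (Ŝ≤T̃ (f , q)))

module _ {n : ℕ} {L : SVSet (Fin n)} (com : IsCOM L) {X : SV (Fin n)} (LX : L X)
         (S : SV (Fin n)) where

  private
    oscFace : ∀ e → Osc (FaceTope L X) (Brk L (X ⊚ S)) e ⇔
                    ((X ⊚ S) e ≢ zer × IncidentEdge (FaceTope L X) (X ⊚ S) e)
    oscFace = Osc-⇔ (FaceTope L X) (IsTope L) proj₁ (X ⊚ S)

  osc-contraction⇔osc-face : ∀ e (p : X e ≡ zer) →
    Osc (IsTope (Contr L X)) (Brk (Contr L X) (restrict X (X ⊚ S))) (e , p)
      ⇔ Osc (FaceTope L X) (Brk L (X ⊚ S)) e
  osc-contraction⇔osc-face e p =
    mk⇔ (from (oscFace e) ∘ map₂ (lift-incident com LX p) ∘ to oscContr)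
        (from oscContr ∘ map₂ (restrict-incident com p ∘ IncidentEdge-monoᵛ proj₁) ∘ to (oscFace e))
    where
    oscContr : Osc (IsTope (Contr L X)) (Brk (Contr L X) (restrict X (X ⊚ S))) (e , p) ⇔
               ((X ⊚ S) e ≢ zer × IncidentEdge (IsTope (Contr L X)) (restrict X (X ⊚ S)) (e , p))
    oscContr = Osc-⇔ (IsTope (Contr L X)) (IsTope (Contr L X)) id (restrict X (X ⊚ S)) (e , p)

  osc-face⇔osc-sample : (∀ e → ¬ Sep X S e) → ∀ e →
    Osc (FaceTope L X) (Brk L (X ⊚ S)) e ⇔ (Osc (IsTope L) (Brk L S) e × X e ≡ zer)
  osc-face⇔osc-sample noSep e = mk⇔ face⇒sample sample⇒face
    where
    oscSample : Osc (IsTope L) (Brk L S) e ⇔ (S e ≢ zer × IncidentEdge (IsTope L) S e)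
    oscSample = Osc-⇔ (IsTope L) (IsTope L) id S e

    face⇒sample : Osc (FaceTope L X) (Brk L (X ⊚ S)) e → Osc (IsTope L) (Brk L S) e × X e ≡ zer
    face⇒sample o with to (oscFace e) o
    ... | Ŝe≢0 , edge@(_ , _ , (_ , X≤T) , (_ , X≤T') , d , _) =
      from oscSample
        ( Ŝe≢0 ∘ trans (⊚-zeroˡ {X = X} {Y = S} Xe≡0)
        , IncidentEdge-antitoneˢ (≤ᵛ-⊚-unseparated X S noSep) (IncidentEdge-monoᵛ proj₁ edge)) ,
      Xe≡0
      where
      Xe≡0 : X e ≡ zer
      Xe≡0 = ≤ᵛ-DiffOnly⇒zero X≤T X≤T' d

    sample⇒face : Osc (IsTope L) (Brk L S) e × X e ≡ zer → Osc (FaceTope L X) (Brk L (X ⊚ S)) e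
    sample⇒face (o , Xe≡0) with to oscSample o
    ... | Se≢0 , edge =
      from (oscFace e)
        ( Se≢0 ∘ trans (sym (⊚-zeroˡ {X = X} {Y = S} Xe≡0))
        , lift-incident com LX Xe≡0
            (IncidentEdge-antitoneˢ (λ (_ , q) → inj₂ (⊚-zeroˡ {X = X} {Y = S} q))
              (restrict-incident com Xe≡0 edge)))

lemma24 : {n : ℕ} (L : SVSet (Fin n)) → IsCOM L →
    (X S : SV (Fin n)) → L X → Samp L S → (∀ e → ¬ Sep X S e) →
    let Ŝ = X ⊚ S
        Ŝ̂ = restrict X Ŝ
    in
    ((∀ e (p : X e ≡ zer) →
        Osc (IsTope (Contr L X)) (Brk (Contr L X) Ŝ̂) (e , p)
          ⇔ Osc (FaceTope L X) (Brk L Ŝ) e)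
     × (∀ e →
        Osc (FaceTope L X) (Brk L Ŝ) e
          ⇔ (Osc (IsTope L) (Brk L S) e × X e ≡ zer)))
    ×
    ((∀ e (p : X e ≡ zer) → (Ŝ̂ (e , p) ≡ zer) ⇔ (Ŝ e ≡ zer))
     × (∀ e → (Ŝ e ≡ zer) ⇔ (S e ≡ zer × X e ≡ zer)))
lemma24 L com X S LX _ noSep =
  (osc-contraction⇔osc-face com LX S , osc-face⇔osc-sample com LX S noSep) ,
  ((λ _ _ → mk⇔ id id) , λ _ → ⊚-zero⇔ {X = X} {Y = S})
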